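{- For every positive integer $h$, the average distance of the multiplicative circulant graph $\Gamma_{3^h}=MC(3^h)$ is $$\mu(\Gamma_{3^h})=\frac{2h\cdot 3^{h-1}}{3^h-1}.$$
   Context: For integers $m>1$, $h>0$, $MC(m^h)$ is the graph with vertex set $\mathbb{Z}_{m^h}$ in which distinct vertices $x,y$ are adjacent iff $x-y\equiv \pm m^i \pmod{m^h}$ for some $i\in\{0,\ldots,h-1\}$. For a graph $\Gamma$ with $N$ vertices, the average distance is $\mu(\Gamma)=\frac{1}{N(N-1)}\sum_{v_i,v_j\in V(\Gamma)} d_\Gamma(v_i,v_j)$, the sum over all ordered pairs of vertices, where $d_\Gamma$ is shortest-path distance. -}

module Defs where

open import Data.Nat using (ℕ; zero; suc; _+_; _*_; _∸_; _^_; _≡ᵇ_; _%_; NonZero)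
open import Data.Nat.DivMod using ()
open import Data.Bool using (Bool; true; false; _∧_; _∨_; not; if_then_else_)
open import Data.Fin using (Fin; toℕ)
open import Data.List using (List; map; allFin; upTo)
open import Data.Nat.ListAction using (sum)
open import Data.Bool.ListAction using (any)
open import Data.Nat.Properties using (m^n≢0)
open import Data.Integer using (+_)
open import Data.Rational using (ℚ; 0ℚ; _/_)

Graph : ℕ → Set
Graph n = Fin n → Fin n → Bool

ball : ∀ {n} → Graph n → ℕ → Fin n → Fin n → Bool
ball G zero    x y = toℕ x ≡ᵇ toℕ y
ball G (suc k) x y = ball G k x y ∨ any (λ z → ball G k x z ∧ G z y) (allFin _)

firstFrom : ∀ {n} → Graph n → Fin n → Fin n → ℕ → ℕ → ℕ
firstFrom G x y j zero       = j
firstFrom G x y j (suc fuel) =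
  if ball G j x y then j else firstFrom G x y (suc j) fuel

-- A shortest path in an n-vertex graph has length < n, so searching
-- k = 0 .. n-1 suffices; the fallback value n only occurs for vertices in
-- different components (never for the connected graphs MC(m^h)).
dist : ∀ {n} → Graph n → Fin n → Fin n → ℕ
dist {n} G x y = firstFrom G x y 0 n

distSum : ∀ {n} → Graph n → ℕ
distSum {n} G = sum (map (λ x → sum (map (λ y → dist G x y) (allFin n))) (allFin n))

-- a / b as a rational number (with the harmless convention a / 0 = 0).
_/ℕ_ : ℕ → ℕ → ℚ
a /ℕ zero  = 0ℚ
a /ℕ suc b = (+ a) / suc b

avgDist : ∀ {n} → Graph n → ℚ
avgDist {n} G = distSum G /ℕ (n * (n ∸ 1))

-- Multiplicative circulant graph MC(m^h) on Z_{m^h}: distinct x, y are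
-- adjacent iff x - y ≡ ± m^i (mod m^h) for some i ∈ {0, …, h-1}.
MC : (m h : ℕ) .{{_ : NonZero m}} → Graph (m ^ h)
MC m h {{nz}} x y =
  not (toℕ x ≡ᵇ toℕ y) ∧
  any (λ i → (((toℕ x + N ∸ toℕ y) % N) ≡ᵇ ((m ^ i) % N)) ∨
             (((toℕ y + N ∸ toℕ x) % N) ≡ᵇ ((m ^ i) % N)))
      (upTo h)
  where
  N = m ^ h
  instance
    nzN : NonZero N
    nzN = m^n≢0 m h

-- In MC(3^h) the translations x ↦ x + c are automorphisms, so d(x, y) depends only on
-- d = y − x mod 3^h, and a walk from x to y of length k is a way of writing d as a sum of k
-- terms ±3^i. Hence d(x, y) is the number of nonzero digits among the h balanced-ternary
-- digits of d: this weight changes by at most one under d ↦ d ± 3^i, and a nonzero weight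
-- can always be lowered by one such step. Splitting d = r + 3q gives w_{h+1}(3q) = w_h(q),
-- w_{h+1}(3q+1) = 1 + w_h(q) and w_{h+1}(3q+2) = 1 + w_h(q+1), so S_h = Σ_{d<3^h} w_h(d)
-- satisfies S_{h+1} = 3 S_h + 2·3^h, i.e. S_h = 2h·3^(h-1). Every vertex sees the distances
-- w_h(0), …, w_h(3^h − 1) once each, so μ = 3^h S_h / (3^h (3^h − 1)).

module Submission where

open import Data.Bool using (true; false; T; not)
open import Data.Bool.Properties using (T-∨; T-∧)
open import Data.Fin using (Fin; toℕ; fromℕ<)
open import Data.Fin.Properties using (toℕ-injective; toℕ<n; toℕ-fromℕ<)
import Data.Integer as ℤ
import Data.Integer.Properties as ℤ
open import Data.List using (allFin; upTo; tabulate; map)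
open import Data.List.Membership.Propositional using (find; lose)
open import Data.List.Membership.Propositional.Properties using (∈-allFin; ∈-upTo⁺; ∈-upTo⁻)
open import Data.List.Properties using (map-tabulate)
open import Data.List.Relation.Unary.Any.Properties using (any⁺; any⁻)
open import Data.Nat
open import Data.Nat.DivMod
open import Data.Nat.Divisibility using (_∣_; divides; *-monoʳ-∣; 1∣_; n∣m⇒m%n≡0)
open import Data.Nat.ListAction using (sum)
open import Data.Nat.Properties
open import Data.Nat.Tactic.RingSolver using (solve-∀)
open import Algebra.Properties.CommutativeSemigroup +-commutativeSemigroup using (interchange; xy∙z≈xz∙y)
open import Data.Product using (∃-syntax; _×_; _,_; proj₁; proj₂)
open import Data.Rational.Properties using (fromℚᵘ-cong)
open import Data.Rational.Unnormalised using (mkℚᵘ; *≡*)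
open import Data.Sum using (_⊎_; inj₁; inj₂)
import Data.Sum as Sum
open import Function using (id; _∘_; _⇔_; mk⇔; Equivalence)
open import Relation.Binary.PropositionalEquality
open import Relation.Nullary using (yes; no; contradiction)

open import Defs

-- Finite sums

sumBelow : ℕ → (ℕ → ℕ) → ℕ
sumBelow zero    f = 0
sumBelow (suc n) f = f 0 + sumBelow n (f ∘ suc)

sumBelow-cong : ∀ n {f g} → (∀ i → f i ≡ g i) → sumBelow n f ≡ sumBelow n g
sumBelow-cong zero    f≗g = refl
sumBelow-cong (suc n) f≗g = cong₂ _+_ (f≗g 0) (sumBelow-cong n (f≗g ∘ suc))

sumBelow-+ : ∀ n f g → sumBelow n (λ i → f i + g i) ≡ sumBelow n f + sumBelow n g
sumBelow-+ zero    f g = refl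
sumBelow-+ (suc n) f g =
  trans (cong (f 0 + g 0 +_) (sumBelow-+ n (f ∘ suc) (g ∘ suc))) (interchange (f 0) (g 0) _ _)

sumBelow-const : ∀ n c → sumBelow n (λ _ → c) ≡ n * c
sumBelow-const zero    c = refl
sumBelow-const (suc n) c = cong (c +_) (sumBelow-const n c)

sumBelow-1+ : ∀ n f → sumBelow n (λ i → suc (f i)) ≡ n + sumBelow n f
sumBelow-1+ n f = trans (sumBelow-+ n (λ _ → 1) f) (cong (_+ sumBelow n f) (trans (sumBelow-const n 1) (*-identityʳ n)))

sum-tabulate : ∀ n {f : Fin n → ℕ} {g : ℕ → ℕ} → (∀ i → f i ≡ g (toℕ i)) → sum (tabulate f) ≡ sumBelow n g
sum-tabulate zero    f≗g = refl
sum-tabulate (suc n) f≗g = cong₂ _+_ (f≗g Fin.zero) (sum-tabulate n (f≗g ∘ Fin.suc))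

sumBelow-sucʳ : ∀ n f → sumBelow (suc n) f ≡ sumBelow n f + f n
sumBelow-sucʳ zero    f = +-comm (f 0) 0
sumBelow-sucʳ (suc n) f = begin
  f 0 + sumBelow (suc n) (f ∘ suc)   ≡⟨ cong (f 0 +_) (sumBelow-sucʳ n (f ∘ suc)) ⟩
  f 0 + (sumBelow n (f ∘ suc) + f (suc n)) ≡⟨ +-assoc (f 0) _ _ ⟨
  f 0 + sumBelow n (f ∘ suc) + f (suc n) ∎
  where open ≡-Reasoning

sumBelow-shift : ∀ n f → f n ≡ f 0 → sumBelow n (f ∘ suc) ≡ sumBelow n f
sumBelow-shift n f fn≡f0 = +-cancelˡ-≡ (f 0) _ _ (begin
  f 0 + sumBelow n (f ∘ suc) ≡⟨ sumBelow-sucʳ n f ⟩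
  sumBelow n f + f n          ≡⟨ cong (sumBelow n f +_) fn≡f0 ⟩
  sumBelow n f + f 0          ≡⟨ +-comm (sumBelow n f) (f 0) ⟩
  f 0 + sumBelow n f          ∎)
  where open ≡-Reasoning

sumBelow-rotate : ∀ n g → (∀ d → g (d + n) ≡ g d) → ∀ c → sumBelow n (λ i → g (i + c)) ≡ sumBelow n g
sumBelow-rotate n g periodic zero    = sumBelow-cong n (λ i → cong g (+-identityʳ i))
sumBelow-rotate n g periodic (suc c) = begin
  sumBelow n (λ i → g (i + suc c)) ≡⟨ sumBelow-cong n (λ i → cong g (+-suc i c)) ⟩
  sumBelow n (λ i → g (suc i + c)) ≡⟨ sumBelow-shift n (λ i → g (i + c)) (trans (cong g (+-comm n c)) (periodic c)) ⟩
  sumBelow n (λ i → g (i + c))     ≡⟨ sumBelow-rotate n g periodic c ⟩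
  sumBelow n g                     ∎
  where open ≡-Reasoning

sumBelow-*3 : ∀ n g → sumBelow (n * 3) g ≡ sumBelow n (λ q → g (3 * q) + g (1 + 3 * q) + g (2 + 3 * q))
sumBelow-*3 zero    g = refl
sumBelow-*3 (suc n) g = begin
  g 0 + (g 1 + (g 2 + sumBelow (n * 3) (g ∘ (3 +_))))
    ≡⟨ cong (λ s → g 0 + (g 1 + (g 2 + s))) (sumBelow-*3 n (g ∘ (3 +_))) ⟩
  g 0 + (g 1 + (g 2 + sumBelow n (λ q → g (3 + 3 * q) + g (4 + 3 * q) + g (5 + 3 * q))))
    ≡⟨ +-reassoc (g 0) (g 1) (g 2) _ ⟩
  g 0 + g 1 + g 2 + sumBelow n (λ q → g (3 + 3 * q) + g (4 + 3 * q) + g (5 + 3 * q))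
    ≡⟨ cong (g 0 + g 1 + g 2 +_) (sumBelow-cong n λ q → cong (λ m → g m + g (1 + m) + g (2 + m)) (*-suc 3 q)) ⟨
  g 0 + g 1 + g 2 + sumBelow n (λ q → g (3 * suc q) + g (1 + 3 * suc q) + g (2 + 3 * suc q)) ∎
  where
  open ≡-Reasoning
  +-reassoc : ∀ a b c d → a + (b + (c + d)) ≡ a + b + c + d
  +-reassoc = solve-∀

-- Balanced-ternary weight

-- weight h d counts the nonzero digits among the h lowest balanced-ternary digits of d;
-- a residue 2 is the digit −1 and carries 1 into the next place.
digitWeight : ℕ → ℕ
digitWeight zero    = 0
digitWeight (suc _) = 1

carry : ℕ → ℕ
carry 2 = 1
carry _ = 0

weight : ℕ → ℕ → ℕ
weight zero    d = 0
weight (suc h) d = digitWeight (d % 3) + weight h (carry (d % 3) + d / 3)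

data Ternary : ℕ → Set where
  ternary : ∀ r q → r < 3 → Ternary (r + 3 * q)

ternary-view : ∀ d → Ternary d
ternary-view d = subst Ternary (sym d≡r+3q) (ternary (d % 3) (d / 3) (m%n<n d 3))
  where
  d≡r+3q : d ≡ d % 3 + 3 * (d / 3)
  d≡r+3q = trans (m≡m%n+[m/n]*n d 3) (cong (d % 3 +_) (*-comm (d / 3) 3))

weight-ternary : ∀ h r q → r < 3 → weight (suc h) (r + 3 * q) ≡ digitWeight r + weight h (carry r + q)
weight-ternary h r q r<3 = cong₂ (λ r′ q′ → digitWeight r′ + weight h (carry r′ + q′)) remainder quotient
  where
  remainder : (r + 3 * q) % 3 ≡ r
  remainder = trans (%-remove-+ʳ r (divides q (*-comm 3 q))) (m<n⇒m%n≡m r<3)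
  quotient : (r + 3 * q) / 3 ≡ q
  quotient = begin
    (r + 3 * q) / 3     ≡⟨ cong (λ m → (r + m) / 3) (*-comm 3 q) ⟩
    (r + q * 3) / 3     ≡⟨ +-distrib-/-∣ʳ r (divides q refl) ⟩
    r / 3 + q * 3 / 3   ≡⟨ cong₂ _+_ (m<n⇒m/n≡0 r<3) (m*n/n≡m q 3) ⟩
    q                   ∎
    where open ≡-Reasoning

weight-3q : ∀ h q → weight (suc h) (3 * q) ≡ weight h q
weight-3q h q = weight-ternary h 0 q z<s

weight-3q+1 : ∀ h q → weight (suc h) (1 + 3 * q) ≡ suc (weight h q)
weight-3q+1 h q = weight-ternary h 1 q (s≤s z<s)

weight-3q+2 : ∀ h q → weight (suc h) (2 + 3 * q) ≡ suc (weight h (suc q))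
weight-3q+2 h q = weight-ternary h 2 q ≤-refl

weight-ternary-+ : ∀ h r q p → r < 3 → weight (suc h) (r + 3 * q + 3 * p) ≡ digitWeight r + weight h (carry r + q + p)
weight-ternary-+ h r q p r<3 = begin
  weight (suc h) (r + 3 * q + 3 * p)        ≡⟨ cong (weight (suc h)) (regroup r q p) ⟩
  weight (suc h) (r + 3 * (q + p))          ≡⟨ weight-ternary h r (q + p) r<3 ⟩
  digitWeight r + weight h (carry r + (q + p)) ≡⟨ cong (λ m → digitWeight r + weight h m) (+-assoc (carry r) q p) ⟨
  digitWeight r + weight h (carry r + q + p) ∎
  where
  open ≡-Reasoning
  regroup : ∀ r q p → r + 3 * q + 3 * p ≡ r + 3 * (q + p)
  regroup = solve-∀

weight-zero : ∀ h → weight h 0 ≡ 0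
weight-zero zero    = refl
weight-zero (suc h) = weight-zero h

weight-≤ : ∀ h d → weight h d ≤ h
weight-≤ zero    d = z≤n
weight-≤ (suc h) d = +-mono-≤ (digitWeight≤1 (d % 3)) (weight-≤ h _)
  where
  digitWeight≤1 : ∀ r → digitWeight r ≤ 1
  digitWeight≤1 zero    = z≤n
  digitWeight≤1 (suc _) = ≤-refl

weight-periodic : ∀ h d → weight h (d + 3 ^ h) ≡ weight h d
weight-periodic zero    d = refl
weight-periodic (suc h) d with ternary-view d
... | ternary r q r<3 = begin
  weight (suc h) (r + 3 * q + 3 * 3 ^ h)        ≡⟨ weight-ternary-+ h r q (3 ^ h) r<3 ⟩
  digitWeight r + weight h (carry r + q + 3 ^ h) ≡⟨ cong (digitWeight r +_) (weight-periodic h _) ⟩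
  digitWeight r + weight h (carry r + q)         ≡⟨ weight-ternary h r q r<3 ⟨
  weight (suc h) (r + 3 * q)                     ∎
  where open ≡-Reasoning

weight-+-multiple : ∀ h d k → weight h (d + k * 3 ^ h) ≡ weight h d
weight-+-multiple h d zero    = cong (weight h) (+-identityʳ d)
weight-+-multiple h d (suc k) = begin
  weight h (d + (3 ^ h + k * 3 ^ h)) ≡⟨ cong (weight h) (regroup d (3 ^ h) (k * 3 ^ h)) ⟩
  weight h (d + k * 3 ^ h + 3 ^ h)   ≡⟨ weight-periodic h _ ⟩
  weight h (d + k * 3 ^ h)           ≡⟨ weight-+-multiple h d k ⟩
  weight h d                         ∎
  where
  open ≡-Reasoning
  regroup : ∀ d p m → d + (p + m) ≡ d + m + p
  regroup = solve-∀

Near : ℕ → ℕ → Set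
Near a b = a ≤ suc b × b ≤ suc a

near-sym : ∀ {a b} → Near a b → Near b a
near-sym (a≤ , b≤) = b≤ , a≤

near-+ˡ : ∀ c {a b} → Near a b → Near (c + a) (c + b)
near-+ˡ zero    near          = near
near-+ˡ (suc c) near with a≤ , b≤ ← near-+ˡ c near = s≤s a≤ , s≤s b≤

near-transport : ∀ {a a′ b b′} → a ≡ a′ → b ≡ b′ → Near a′ b′ → Near a b
near-transport refl refl near = near

near-suc : ∀ a → Near (suc a) a
near-suc a = ≤-refl , ≤-trans (n≤1+n a) (n≤1+n (suc a))

weight-near : ∀ h i d → Near (weight h (d + 3 ^ i)) (weight h d)
weight-near zero    i       d = z≤n , z≤n
weight-near (suc h) (suc i) d with ternary-view d
... | ternary r q r<3 =
  near-transport (weight-ternary-+ h r q (3 ^ i) r<3) (weight-ternary h r q r<3)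
    (near-+ˡ (digitWeight r) (weight-near h i (carry r + q)))
weight-near (suc h) zero    d with ternary-view d
... | ternary r q r<3 = near-transport (cong (weight (suc h)) (+-comm (r + 3 * q) 1)) refl (near-successor r r<3)
  where
  w = weight (suc h)
  near-successor : ∀ r → r < 3 → Near (w (suc r + 3 * q)) (w (r + 3 * q))
  near-successor 0 _ = near-transport (weight-3q+1 h q) (weight-3q h q)
    (near-suc (weight h q))
  near-successor 1 _ = near-transport (weight-3q+2 h q) (weight-3q+1 h q)
    (near-+ˡ 1 (near-transport (cong (weight h) (+-comm 1 q)) refl (weight-near h 0 q)))
  near-successor 2 _ = near-transport (trans (cong w (sym (*-suc 3 q))) (weight-3q h (suc q))) (weight-3q+2 h q)
    (near-sym (near-suc (weight h (suc q))))
  near-successor (suc (suc (suc _))) (s≤s (s≤s (s≤s ())))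

-- d + (3 ^ h ∸ 3 ^ i) is d − 3^i modulo 3^h.
weight-descent : ∀ h d k → weight h d ≡ suc k →
  ∃[ i ] i < h × (weight h (d + 3 ^ i) ≤ k ⊎ weight h (d + (3 ^ h ∸ 3 ^ i)) ≤ k)
weight-descent (suc h) d k w≡1+k with ternary-view d
... | ternary 0 q _ with weight-descent h q k (trans (sym (weight-3q h q)) w≡1+k)
...   | i , i<h , shifted = suc i , s≤s i<h , Sum.map (lift (3 ^ i)) lift-complement shifted
  where
  lift : ∀ p → weight h (q + p) ≤ k → weight (suc h) (3 * q + 3 * p) ≤ k
  lift p = ≤-trans (≤-reflexive (weight-ternary-+ h 0 q p z<s))
  lift-complement : weight h (q + (3 ^ h ∸ 3 ^ i)) ≤ k → weight (suc h) (3 * q + (3 ^ suc h ∸ 3 ^ suc i)) ≤ k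
  lift-complement = subst (λ m → weight (suc h) (3 * q + m) ≤ k) (*-distribˡ-∸ 3 (3 ^ h) (3 ^ i)) ∘ lift _
weight-descent (suc h) d k w≡1+k | ternary 1 q _ = 0 , z<s , inj₂ (≤-reflexive (begin
  weight (suc h) (1 + 3 * q + (3 ^ suc h ∸ 1)) ≡⟨ cong (weight (suc h)) borrow ⟩
  weight (suc h) (3 * q + 3 * 3 ^ h)           ≡⟨ weight-ternary-+ h 0 q (3 ^ h) z<s ⟩
  weight h (q + 3 ^ h)                         ≡⟨ weight-periodic h q ⟩
  weight h q                                   ≡⟨ suc-injective (trans (sym (weight-3q+1 h q)) w≡1+k) ⟩
  k                                            ∎))
  where
  open ≡-Reasoning
  borrow : 1 + 3 * q + (3 ^ suc h ∸ 1) ≡ 3 * q + 3 ^ suc h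
  borrow = begin
    1 + 3 * q + (3 ^ suc h ∸ 1)   ≡⟨ cong (_+ (3 ^ suc h ∸ 1)) (+-comm 1 (3 * q)) ⟩
    3 * q + 1 + (3 ^ suc h ∸ 1)   ≡⟨ +-assoc (3 * q) 1 _ ⟩
    3 * q + (1 + (3 ^ suc h ∸ 1)) ≡⟨ cong (3 * q +_) (m+[n∸m]≡n (m^n>0 3 (suc h))) ⟩
    3 * q + 3 ^ suc h             ∎
weight-descent (suc h) d k w≡1+k | ternary 2 q _ = 0 , z<s , inj₁ (≤-reflexive (begin
  weight (suc h) (2 + 3 * q + 1) ≡⟨ cong (weight (suc h)) (trans (+-comm _ 1) (sym (*-suc 3 q))) ⟩
  weight (suc h) (3 * suc q)     ≡⟨ weight-3q h (suc q) ⟩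
  weight h (suc q)               ≡⟨ suc-injective (trans (sym (weight-3q+2 h q)) w≡1+k) ⟩
  k                              ∎))
  where open ≡-Reasoning
weight-descent (suc h) d k w≡1+k | ternary (suc (suc (suc _))) q (s≤s (s≤s (s≤s ())))

weight≡0⇒∣ : ∀ h d → weight h d ≡ 0 → 3 ^ h ∣ d
weight≡0⇒∣ zero    d _ = 1∣ d
weight≡0⇒∣ (suc h) d w≡0 with ternary-view d
... | ternary 0 q _ = *-monoʳ-∣ 3 (weight≡0⇒∣ h q (trans (sym (weight-3q h q)) w≡0))
... | ternary 1 q _ = contradiction (trans (sym (weight-3q+1 h q)) w≡0) 1+n≢0
... | ternary 2 q _ = contradiction (trans (sym (weight-3q+2 h q)) w≡0) 1+n≢0
... | ternary (suc (suc (suc _))) q (s≤s (s≤s (s≤s ())))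

sumBelow-weight-recurrence : ∀ h → sumBelow (3 ^ suc h) (weight (suc h)) ≡ 3 * sumBelow (3 ^ h) (weight h) + 2 * 3 ^ h
sumBelow-weight-recurrence h = begin
  sumBelow (3 * M) (weight (suc h))
    ≡⟨ cong (λ n → sumBelow n (weight (suc h))) (*-comm 3 M) ⟩
  sumBelow (M * 3) (weight (suc h))
    ≡⟨ sumBelow-*3 M (weight (suc h)) ⟩
  sumBelow M (λ q → weight (suc h) (3 * q) + weight (suc h) (1 + 3 * q) + weight (suc h) (2 + 3 * q))
    ≡⟨ sumBelow-cong M (λ q → cong₂ _+_ (cong₂ _+_ (weight-3q h q) (weight-3q+1 h q)) (weight-3q+2 h q)) ⟩
  sumBelow M (λ q → w q + suc (w q) + suc (w (suc q)))
    ≡⟨ sumBelow-+ M (λ q → w q + suc (w q)) (λ q → suc (w (suc q))) ⟩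
  sumBelow M (λ q → w q + suc (w q)) + sumBelow M (λ q → suc (w (suc q)))
    ≡⟨ cong (_+ sumBelow M (λ q → suc (w (suc q)))) (sumBelow-+ M w (λ q → suc (w q))) ⟩
  S + sumBelow M (λ q → suc (w q)) + sumBelow M (λ q → suc (w (suc q)))
    ≡⟨ cong₂ (λ a b → S + a + b) (sumBelow-1+ M w) (sumBelow-1+ M (w ∘ suc)) ⟩
  S + (M + S) + (M + sumBelow M (w ∘ suc))
    ≡⟨ cong (λ t → S + (M + S) + (M + t)) (sumBelow-shift M w (weight-periodic h 0)) ⟩
  S + (M + S) + (M + S)
    ≡⟨ collect S M ⟩
  3 * S + 2 * M ∎
  where
  open ≡-Reasoning
  M = 3 ^ h
  w = weight h
  S = sumBelow M w
  collect : ∀ S M → S + (M + S) + (M + S) ≡ 3 * S + 2 * M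
  collect = solve-∀

sumBelow-weight : ∀ h → sumBelow (3 ^ suc h) (weight (suc h)) ≡ 2 * suc h * 3 ^ h
sumBelow-weight zero    = refl
sumBelow-weight (suc h) = begin
  sumBelow (3 ^ suc (suc h)) (weight (suc (suc h)))          ≡⟨ sumBelow-weight-recurrence (suc h) ⟩
  3 * sumBelow (3 ^ suc h) (weight (suc h)) + 2 * 3 ^ suc h  ≡⟨ cong (λ S → 3 * S + 2 * 3 ^ suc h) (sumBelow-weight h) ⟩
  3 * (2 * suc h * 3 ^ h) + 2 * 3 ^ suc h                    ≡⟨ collect h (3 ^ h) ⟩
  2 * suc (suc h) * 3 ^ suc h                                ∎
  where
  open ≡-Reasoning
  collect : ∀ h M → 3 * (2 * (1 + h) * M) + 2 * (3 * M) ≡ 2 * (2 + h) * (3 * M)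
  collect = solve-∀

-- Distances characterised by breadth-first layers

≢⇒T-not-≡ᵇ : ∀ {m n} → m ≢ n → T (not (m ≡ᵇ n))
≢⇒T-not-≡ᵇ {m} {n} m≢n with m ≡ᵇ n in m≡ᵇn
... | true  = m≢n (≡ᵇ⇒≡ m n (subst T (sym m≡ᵇn) _))
... | false = _

record IsDistanceFrom {n} (G : Graph n) (x : Fin n) (δ : Fin n → ℕ) : Set where
  field
    δ-source  : δ x ≡ 0
    δ≡0⇒≡    : ∀ {y} → δ y ≡ 0 → x ≡ y
    δ-edge    : ∀ {y z} → T (G y z) → δ z ≤ suc (δ y)
    δ-descent : ∀ {z k} → δ z ≡ suc k → ∃[ y ] δ y ≤ k × T (G y z)

module _ {n} {G : Graph n} {x : Fin n} {δ : Fin n → ℕ} (isDistance : IsDistanceFrom G x δ) where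

  open IsDistanceFrom isDistance

  ball⇒δ≤ : ∀ k y → T (ball G k x y) → δ y ≤ k
  ball⇒δ≤ zero    y x≡y = ≤-reflexive (trans (cong δ (sym (toℕ-injective (≡ᵇ⇒≡ _ _ x≡y)))) δ-source)
  ball⇒δ≤ (suc k) y reach with Equivalence.to T-∨ reach
  ... | inj₁ within-k = m≤n⇒m≤1+n (ball⇒δ≤ k y within-k)
  ... | inj₂ via-edge with z , _ , z-edge ← find (any⁻ _ (allFin n) via-edge) =
    let (within-k , edge) = Equivalence.to T-∧ z-edge in ≤-trans (δ-edge edge) (s≤s (ball⇒δ≤ k z within-k))

  δ≤⇒ball : ∀ k y → δ y ≤ k → T (ball G k x y)
  δ≤⇒ball zero    y δ≤0 = ≡⇒≡ᵇ _ _ (cong toℕ (δ≡0⇒≡ (n≤0⇒n≡0 δ≤0)))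
  δ≤⇒ball (suc k) y δ≤1+k with δ y ≤? k
  ... | yes δ≤k = Equivalence.from T-∨ (inj₁ (δ≤⇒ball k y δ≤k))
  ... | no  δ≰k with z , δz≤k , edge ← δ-descent (≤-antisym δ≤1+k (≰⇒> δ≰k)) =
    Equivalence.from T-∨ (inj₂ (any⁺ _ (lose (∈-allFin z) (Equivalence.from T-∧ (δ≤⇒ball k z δz≤k , edge)))))

  firstFrom≡δ : ∀ y fuel j → j ≤ δ y → δ y ≤ j + fuel → firstFrom G x y j fuel ≡ δ y
  firstFrom≡δ y zero       j j≤δ δ≤j+0 = ≤-antisym j≤δ (≤-trans δ≤j+0 (≤-reflexive (+-identityʳ j)))
  firstFrom≡δ y (suc fuel) j j≤δ δ≤j+1+fuel with ball G j x y in reached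
  ... | true  = ≤-antisym j≤δ (ball⇒δ≤ j y (subst T (sym reached) _))
  ... | false = firstFrom≡δ y fuel (suc j) (≤∧≢⇒< j≤δ j≢δ) (≤-trans δ≤j+1+fuel (≤-reflexive (+-suc j fuel)))
    where
    j≢δ : j ≢ δ y
    j≢δ j≡δ = subst T reached (δ≤⇒ball j y (≤-reflexive (sym j≡δ)))

  dist≡δ : ∀ y → δ y ≤ n → dist G x y ≡ δ y
  dist≡δ y δ≤n = firstFrom≡δ y n 0 z≤n δ≤n

-- Arithmetic modulo N

module Residues (N : ℕ) .{{_ : NonZero N}} where

  infix 4 _≈_
  _≈_ : ℕ → ℕ → Set
  a ≈ b = a % N ≡ b % N

  -- The difference a − b in ℤ_N, written without truncation (for b ≤ N) as in the definition of MC.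
  _⊖_ : ℕ → ℕ → ℕ
  a ⊖ b = a + N ∸ b

  %-≈ : ∀ a → a % N ≈ a
  %-≈ a = m%n%n≡m%n a N

  +N-≈ : ∀ a → a + N ≈ a
  +N-≈ a = [m+n]%n≡m%n a N

  ≈-+ : ∀ {a b c d} → a ≈ b → c ≈ d → a + c ≈ b + d
  ≈-+ {a} {b} {c} {d} a≈b c≈d = begin
    (a + c) % N               ≡⟨ %-distribˡ-+ a c N ⟩
    (a % N + c % N) % N       ≡⟨ cong₂ (λ x y → (x + y) % N) a≈b c≈d ⟩
    (b % N + d % N) % N       ≡⟨ %-distribˡ-+ b d N ⟨
    (b + d) % N               ∎
    where open ≡-Reasoning

  ≈-cancelʳ : ∀ {a b} c → a + c ≈ b + c → a ≈ b
  ≈-cancelʳ {a} {b} c a+c≈b+c = begin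
    a % N              ≡⟨ add-inverse a ⟨
    (a + c + c⁻) % N   ≡⟨ ≈-+ a+c≈b+c refl ⟩
    (b + c + c⁻) % N   ≡⟨ add-inverse b ⟩
    b % N              ∎
    where
    open ≡-Reasoning
    c⁻ = N ∸ c % N
    add-inverse : ∀ x → x + c + c⁻ ≈ x
    add-inverse x = begin
      (x + c + c⁻) % N         ≡⟨ ≈-+ (≈-+ {x} refl (%-≈ c)) refl ⟨
      (x + c % N + c⁻) % N     ≡⟨ cong (_% N) (+-assoc x (c % N) c⁻) ⟩
      (x + (c % N + c⁻)) % N   ≡⟨ cong (λ y → (x + y) % N) (m+[n∸m]≡n (<⇒≤ (m%n<n c N))) ⟩
      (x + N) % N              ≡⟨ +N-≈ x ⟩
      x % N                    ∎

  ≈⇒≡ : ∀ {a b} → a < N → b < N → a ≈ b → a ≡ b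
  ≈⇒≡ a<N b<N a≈b = trans (sym (m<n⇒m%n≡m a<N)) (trans a≈b (m<n⇒m%n≡m b<N))

  ⊖-+ : ∀ a {b} → b ≤ N → (a ⊖ b) + b ≈ a
  ⊖-+ a {b} b≤N = trans (cong (_% N) (m∸n+n≡m (≤-trans b≤N (m≤n+m N a)))) (+N-≈ a)

  ⊖-≈ : ∀ a {b} c → b ≤ N → a ⊖ b ≈ c ⇔ a ≈ b + c
  ⊖-≈ a {b} c b≤N = mk⇔ to from
    where
    to : a ⊖ b ≈ c → a ≈ b + c
    to a⊖b≈c = trans (sym (⊖-+ a b≤N)) (trans (≈-+ a⊖b≈c refl) (cong (_% N) (+-comm c b)))
    from : a ≈ b + c → a ⊖ b ≈ c
    from a≈b+c = ≈-cancelʳ b (trans (⊖-+ a b≤N) (trans a≈b+c (cong (_% N) (+-comm b c))))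

-- The graph MC(3^h)

n≤3^n : ∀ n → n ≤ 3 ^ n
n≤3^n zero    = z≤n
n≤3^n (suc n) = +-mono-≤ (m^n>0 3 n) (≤-trans (n≤3^n n) (m≤m+n (3 ^ n) _))

module _ (h : ℕ) where

  private
    instance
      3^h-nonZero : NonZero (3 ^ h)
      3^h-nonZero = m^n≢0 3 h

  open Residues (3 ^ h)

  weight-% : ∀ d → weight h (d % 3 ^ h) ≡ weight h d
  weight-% d = begin
    weight h (d % 3 ^ h)                       ≡⟨ weight-+-multiple h (d % 3 ^ h) (d / 3 ^ h) ⟨
    weight h (d % 3 ^ h + (d / 3 ^ h) * 3 ^ h) ≡⟨ cong (weight h) (m≡m%n+[m/n]*n d (3 ^ h)) ⟨
    weight h d                                 ∎
    where open ≡-Reasoning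

  weight-≈ : ∀ {a b} → a ≈ b → weight h a ≡ weight h b
  weight-≈ {a} {b} a≈b = trans (sym (weight-% a)) (trans (cong (weight h) a≈b) (weight-% b))

  weight≡0⇒≈0 : ∀ d → weight h d ≡ 0 → d ≈ 0
  weight≡0⇒≈0 d w≡0 = trans (n∣m⇒m%n≡0 d (3 ^ h) (weight≡0⇒∣ h d w≡0)) (sym (m<n⇒m%n≡m (m^n>0 3 h)))

  infix 4 _∼_
  _∼_ : ℕ → ℕ → Set
  a ∼ b = ∃[ i ] i < h × (b ≈ a + 3 ^ i ⊎ a ≈ b + 3 ^ i)

  ∼-resp-≈ : ∀ {a a′ b b′} → a ≈ a′ → b ≈ b′ → a ∼ b → a′ ∼ b′
  ∼-resp-≈ {a} {a′} {b} {b′} a≈a′ b≈b′ (i , i<h , step) = i , i<h , Sum.map forward backward step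
    where
    forward : b ≈ a + 3 ^ i → b′ ≈ a′ + 3 ^ i
    forward b≈ = trans (sym b≈b′) (trans b≈ (≈-+ a≈a′ refl))
    backward : a ≈ b + 3 ^ i → a′ ≈ b′ + 3 ^ i
    backward a≈ = trans (sym a≈a′) (trans a≈ (≈-+ b≈b′ refl))

  ∼-+ʳ : ∀ {a b} c → a ∼ b → a + c ∼ b + c
  ∼-+ʳ {a} {b} c (i , i<h , step) = i , i<h , Sum.map (shift a b) (shift b a) step
    where
    shift : ∀ x y → y ≈ x + 3 ^ i → y + c ≈ x + c + 3 ^ i
    shift x y y≈ = trans (≈-+ y≈ refl) (cong (_% 3 ^ h) (xy∙z≈xz∙y x (3 ^ i) c))

  ∼-cancelʳ : ∀ {a b} c → a + c ∼ b + c → a ∼ b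
  ∼-cancelʳ {a} {b} c (i , i<h , step) = i , i<h , Sum.map (unshift a b) (unshift b a) step
    where
    unshift : ∀ x y → y + c ≈ x + c + 3 ^ i → y ≈ x + 3 ^ i
    unshift x y y+c≈ = ≈-cancelʳ c (trans y+c≈ (cong (_% 3 ^ h) (xy∙z≈xz∙y x c (3 ^ i))))

  weight-∼ : ∀ {a b} → a ∼ b → weight h b ≤ suc (weight h a)
  weight-∼ {a} {b} (i , _ , inj₁ b≈a+3^i) = ≤-trans (≤-reflexive (weight-≈ b≈a+3^i)) (proj₁ (weight-near h i a))
  weight-∼ {a} {b} (i , _ , inj₂ a≈b+3^i) = ≤-trans (proj₂ (weight-near h i b)) (s≤s (≤-reflexive (weight-≈ (sym a≈b+3^i))))

  weight-descent-∼ : ∀ d k → weight h d ≡ suc k → ∃[ d′ ] weight h d′ ≤ k × d′ ∼ d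
  weight-descent-∼ d k w≡1+k with weight-descent h d k w≡1+k
  ... | i , i<h , inj₁ up   = d + 3 ^ i , up , i , i<h , inj₂ refl
  ... | i , i<h , inj₂ down = d + (3 ^ h ∸ 3 ^ i) , down , i , i<h , inj₁ (begin
    d % 3 ^ h                              ≡⟨ +N-≈ d ⟨
    (d + 3 ^ h) % 3 ^ h                    ≡⟨ cong (λ m → (d + m) % 3 ^ h) (m∸n+n≡m (^-monoʳ-≤ 3 (<⇒≤ i<h))) ⟨
    (d + (3 ^ h ∸ 3 ^ i + 3 ^ i)) % 3 ^ h  ≡⟨ cong (_% 3 ^ h) (+-assoc d _ (3 ^ i)) ⟨
    (d + (3 ^ h ∸ 3 ^ i) + 3 ^ i) % 3 ^ h  ∎)
    where open ≡-Reasoning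

  MC⇒∼ : ∀ {y z} → T (MC 3 h y z) → toℕ y ∼ toℕ z
  MC⇒∼ {y} {z} edge with _ , some-i ← Equivalence.to T-∧ edge
                      with i , i∈upTo , differences ← find (any⁻ _ (upTo h) some-i) =
    i , ∈-upTo⁻ i∈upTo , Sum.swap (Sum.map (undifference (toℕ<n z)) (undifference (toℕ<n y)) (Equivalence.to T-∨ differences))
    where
    undifference : ∀ {a b} → b < 3 ^ h → T ((a ⊖ b) % 3 ^ h ≡ᵇ 3 ^ i % 3 ^ h) → a ≈ b + 3 ^ i
    undifference {a} b<N t = Equivalence.to (⊖-≈ a (3 ^ i) (<⇒≤ b<N)) (≡ᵇ⇒≡ _ _ t)

  ∼⇒MC : ∀ {y z} → toℕ y ≢ toℕ z → toℕ y ∼ toℕ z → T (MC 3 h y z)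
  ∼⇒MC {y} {z} y≢z (i , i<h , step) = Equivalence.from T-∧ (≢⇒T-not-≡ᵇ y≢z , any⁺ _ (lose (∈-upTo⁺ i<h)
    (Equivalence.from T-∨ (Sum.swap (Sum.map (difference (toℕ<n y)) (difference (toℕ<n z)) step)))))
    where
    difference : ∀ {a b} → b < 3 ^ h → a ≈ b + 3 ^ i → T ((a ⊖ b) % 3 ^ h ≡ᵇ 3 ^ i % 3 ^ h)
    difference {a} b<N a≈ = ≡⇒≡ᵇ _ _ (Equivalence.from (⊖-≈ a (3 ^ i) (<⇒≤ b<N)) a≈)

  MC-isDistance : ∀ x → IsDistanceFrom (MC 3 h) x (λ y → weight h (toℕ y ⊖ toℕ x))
  MC-isDistance x = record
    { δ-source  = trans (cong (weight h) (m+n∸m≡n X (3 ^ h))) (trans (weight-periodic h 0) (weight-zero h))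
    ; δ≡0⇒≡    = λ {y} w≡0 → toℕ-injective (sym (≈⇒≡ (toℕ<n y) X<N (trans
                   (Equivalence.to (⊖-≈ (toℕ y) 0 X≤N) (weight≡0⇒≈0 _ w≡0)) (cong (_% 3 ^ h) (+-identityʳ X)))))
    ; δ-edge    = λ edge → weight-∼ (∼-cancelʳ X (∼-resp-≈ (sym (⊖-+ _ X≤N)) (sym (⊖-+ _ X≤N)) (MC⇒∼ edge)))
    ; δ-descent = descent
    }
    where
    X = toℕ x
    X<N : X < 3 ^ h
    X<N = toℕ<n x
    X≤N : X ≤ 3 ^ h
    X≤N = <⇒≤ X<N
    descent : ∀ {z k} → weight h (toℕ z ⊖ X) ≡ suc k → ∃[ y ] weight h (toℕ y ⊖ X) ≤ k × T (MC 3 h y z)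
    descent {z} {k} w≡1+k with d′ , w′≤k , d′∼ ← weight-descent-∼ _ k w≡1+k = y , wy≤k , ∼⇒MC y≢z y∼z
      where
      y : Fin (3 ^ h)
      y = fromℕ< (m%n<n (d′ + X) (3 ^ h))
      y≈ : toℕ y ≈ d′ + X
      y≈ = trans (cong (_% 3 ^ h) (toℕ-fromℕ< _)) (%-≈ (d′ + X))
      wy≤k : weight h (toℕ y ⊖ X) ≤ k
      wy≤k = ≤-trans (≤-reflexive (weight-≈ (Equivalence.from (⊖-≈ (toℕ y) d′ X≤N) (trans y≈ (cong (_% 3 ^ h) (+-comm d′ X)))))) w′≤k
      y∼z : toℕ y ∼ toℕ z
      y∼z = ∼-resp-≈ (sym y≈) (⊖-+ (toℕ z) X≤N) (∼-+ʳ X d′∼)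
      y≢z : toℕ y ≢ toℕ z
      y≢z y≡z = 1+n≰n (≤-trans (≤-reflexive (trans (sym w≡1+k) (cong (λ V → weight h (V ⊖ X)) (sym y≡z)))) wy≤k)

  dist-MC : ∀ x y → dist (MC 3 h) x y ≡ weight h (toℕ y ⊖ toℕ x)
  dist-MC x y = dist≡δ (MC-isDistance x) y (≤-trans (weight-≤ h _) (n≤3^n h))

  distSum-MC : distSum (MC 3 h) ≡ 3 ^ h * sumBelow (3 ^ h) (weight h)
  distSum-MC = begin
    sum (map row (allFin N))          ≡⟨ cong sum (map-tabulate id row) ⟩
    sum (tabulate row)                ≡⟨ sum-tabulate N row≡ ⟩
    sumBelow N (λ _ → S)              ≡⟨ sumBelow-const N S ⟩
    N * S                             ∎
    where
    open ≡-Reasoning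
    N = 3 ^ h
    S = sumBelow N (weight h)
    row : Fin N → ℕ
    row x = sum (map (dist (MC 3 h) x) (allFin N))
    row≡ : ∀ x → row x ≡ S
    row≡ x = begin
      sum (map (dist (MC 3 h) x) (allFin N))   ≡⟨ cong sum (map-tabulate id (dist (MC 3 h) x)) ⟩
      sum (tabulate (dist (MC 3 h) x))         ≡⟨ sum-tabulate N (dist-MC x) ⟩
      sumBelow N (λ Y → weight h (Y + N ∸ X))  ≡⟨ sumBelow-cong N (λ Y → cong (weight h) (+-∸-assoc Y (<⇒≤ (toℕ<n x)))) ⟩
      sumBelow N (λ Y → weight h (Y + (N ∸ X))) ≡⟨ sumBelow-rotate N (weight h) (weight-periodic h) (N ∸ X) ⟩
      S                                        ∎
      where X = toℕ x

/ℕ-cancelˡ : ∀ c a b .{{_ : NonZero c}} → (c * a) /ℕ (c * b) ≡ a /ℕ b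
/ℕ-cancelˡ (suc c) a zero    = cong ((suc c * a) /ℕ_) (*-zeroʳ c)
/ℕ-cancelˡ (suc c) a (suc b) = fromℚᵘ-cong {mkℚᵘ (ℤ.+ (suc c * a)) (b + c * suc b)} {mkℚᵘ (ℤ.+ a) b} (*≡* (begin
  ℤ.+ (suc c * a) ℤ.* ℤ.+ suc b   ≡⟨ ℤ.pos-* (suc c * a) (suc b) ⟨
  ℤ.+ (suc c * a * suc b)         ≡⟨ cong ℤ.+_ (regroup c a b) ⟩
  ℤ.+ (a * (suc c * suc b))       ≡⟨ ℤ.pos-* a (suc c * suc b) ⟩
  ℤ.+ a ℤ.* ℤ.+ (suc c * suc b)   ∎))
  where
  open ≡-Reasoning
  regroup : ∀ c a b → (1 + c) * a * (1 + b) ≡ a * ((1 + c) * (1 + b))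
  regroup = solve-∀

theorem3p27 : (h : ℕ) → 1 ≤ h →
    avgDist (MC 3 h) ≡ (2 * h * 3 ^ (h ∸ 1)) /ℕ (3 ^ h ∸ 1)
theorem3p27 (suc h) _ = begin
  distSum (MC 3 (suc h)) /ℕ (N * (N ∸ 1))  ≡⟨ cong (_/ℕ (N * (N ∸ 1))) (distSum-MC (suc h)) ⟩
  (N * S) /ℕ (N * (N ∸ 1))                 ≡⟨ /ℕ-cancelˡ N S (N ∸ 1) {{m^n≢0 3 (suc h)}} ⟩
  S /ℕ (N ∸ 1)                             ≡⟨ cong (_/ℕ (N ∸ 1)) (sumBelow-weight h) ⟩
  (2 * suc h * 3 ^ h) /ℕ (N ∸ 1)           ∎
  where
  open ≡-Reasoning
  N = 3 ^ suc h
  S = sumBelow N (weight (suc h))
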